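{- Let $\epsilon$ be a fixed rational constant. For integers $1\le m\le n$, let $B=\mathbf{J}_{m\times n}+\epsilon I_{m,n}\in\mathbb{Q}^{m\times n}$, where $\mathbf{J}_{m\times n}$ is the all-ones $m\times n$ matrix and $I_{m,n}$ is the submatrix of the $n\times n$ identity matrix consisting of its first $m$ rows. Then the Moore–Penrose pseudoinverse $B^+$ satisfies $RES(B^+)=O(\log n)$.
   Context: The resolution of a rational number $a/b$ with $a,b\in\mathbb{Z}$ coprime and $b\neq 0$ is $RES(a/b)=\lceil\max\{\log_2|a+1|,\log_2|b+1|\}\rceil$. For a rational matrix $A=(a_{ij})$, $RES(A)=\max_{i,j}RES(a_{ij})$. -}

module Defs where

open import Data.Nat using (ℕ; zero; suc; _⊔_)
open import Data.Nat.Logarithm using (⌈log₂_⌉)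
open import Data.Integer as ℤ using (ℤ; ∣_∣)
open import Data.Rational as ℚ using (ℚ; 0ℚ; 1ℚ; _+_; _*_; ↥_; ↧ₙ_)
open import Data.Fin using (Fin; zero; suc; toℕ)
open import Data.Nat.Properties using (_≟_)
open import Relation.Nullary using (yes; no)
open import Relation.Binary.PropositionalEquality using (_≡_)
open import Data.Product using (_×_)

Mat : ℕ → ℕ → Set
Mat m n = Fin m → Fin n → ℚ

Σℚ : (k : ℕ) → (Fin k → ℚ) → ℚ
Σℚ zero    f = 0ℚ
Σℚ (suc k) f = f zero + Σℚ k (λ i → f (suc i))

_⊗_ : ∀ {m k n} → Mat m k → Mat k n → Mat m n
_⊗_ {k = k} A B i j = Σℚ k (λ l → A i l * B l j)

infixl 7 _⊗_

transpose : ∀ {m n} → Mat m n → Mat n m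
transpose A i j = A j i

_≐_ : ∀ {m n} → Mat m n → Mat m n → Set
A ≐ B = ∀ i j → A i j ≡ B i j

infix 4 _≐_

-- Moore–Penrose conditions: P is the (Moore–Penrose) pseudoinverse of A
-- (over ℚ the conjugate transpose is the transpose)
IsPseudoinverse : ∀ {m n} → Mat m n → Mat n m → Set
IsPseudoinverse A P =
  (A ⊗ P ⊗ A ≐ A) × (P ⊗ A ⊗ P ≐ P) ×
  (transpose (A ⊗ P) ≐ A ⊗ P) × (transpose (P ⊗ A) ≐ P ⊗ A)

J : (m n : ℕ) → Mat m n
J m n i j = 1ℚ

Iₘₙ : (m n : ℕ) → Mat m n
Iₘₙ m n i j with toℕ i ≟ toℕ j
... | yes _ = 1ℚ
... | no  _ = 0ℚ

Bmat : ℚ → (m n : ℕ) → Mat m n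
Bmat ε m n i j = J m n i j + ε * Iₘₙ m n i j

-- Resolution of a rational a/b in lowest terms with b > 0:
-- ⌈max(log₂|a+1|, log₂|b+1|)⌉ = max(⌈log₂|a+1|⌉, ⌈log₂(b+1)⌉)
RESℚ : ℚ → ℕ
RESℚ q = ⌈log₂ ∣ (↥ q) ℤ.+ ℤ.1ℤ ∣ ⌉ ⊔ ⌈log₂ suc (↧ₙ q) ⌉

RES : ∀ {m n} → Mat m n → ℕ
RES {m} {n} A = maxFin m (λ i → maxFin n (λ j → RESℚ (A i j)))
  where
  maxFin : (k : ℕ) → (Fin k → ℕ) → ℕ
  maxFin zero    f = 0
  maxFin (suc k) f = f zero ⊔ maxFin k (λ i → f (suc i))

{-# OPTIONS --safe #-}

-- For ε ≠ 0 and m ≤ n, B Bᵀ = (n + 2ε) J + ε² I is invertible once n is large, with an inverse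
-- M = u J + v I of the same shape, so B⁺ = Bᵀ M and its entries take only three values; for
-- ε = 0, B⁺ = J / (m n). Writing ε = a / b, each value is a quotient of integer polynomials in
-- m, n, a, b of degree ≤ 5, hence of absolute value < n⁶ once n > 6 (|a| + b)⁵, so its
-- resolution is at most 6 log₂ n. Uniqueness of the Moore–Penrose pseudoinverse transfers
-- this bound to every pseudoinverse.

module Submission where

open import Defs
open import Algebra.Bundles using (CommutativeRing)
open import Data.Bool using (Bool; true; false; T)
open import Data.Fin using (Fin; zero; suc; toℕ)
open import Data.Fin.Properties using (toℕ<n)
open import Data.Integer as ℤ using (ℤ; +_; -[1+_]; ∣_∣; 0ℤ)
import Data.Integer.Properties as ℤP
import Data.Integer.Tactic.RingSolver as ℤ-Tactic
open import Data.Nat as ℕ using (ℕ; zero; suc; _≤_; _<_; _^_; _⊔_; z≤n; s≤s; NonZero)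
open import Data.Nat.Coprimality as Coprime using (coprime-divisor)
open import Data.Nat.Divisibility using (divides; ∣⇒≤)
open import Data.Nat.Logarithm using (⌈log₂_⌉; ⌈log₂⌉-mono-≤; ⌈log₂2^n⌉≡n)
open import Data.Nat.Logarithm.Core using (⌈log2⌉)
import Data.Nat.Properties as ℕP
open import Data.Nat.Solver using () renaming (module +-*-Solver to ℕ-Solver)
import Data.Nat.Tactic.RingSolver as ℕ-Tactic
open import Data.Product using (Σ; Σ-syntax; ∃-syntax; _×_; _,_)
open import Data.Rational as ℚ using (ℚ; mkℚ; 0ℚ; 1ℚ; _+_; _*_; -_; _-_; 1/_; ↥_; ↧_; ↧ₙ_)
open import Data.Rational.Literals using (fromℤ)
import Data.Rational.Properties as ℚP
open import Data.Rational.Solver using () renaming (module +-*-Solver to ℚ-Solver)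
import Data.Rational.Unnormalised as ℚᵘ
import Data.Rational.Unnormalised.Properties as ℚᵘP
open import Data.Sum using (_⊎_; inj₁; inj₂; [_,_]′)
open import Function using (_∘_)
open import Induction.WellFounded using (Acc; acc)
open import Relation.Binary.Bundles using (Setoid)
open import Relation.Binary.PropositionalEquality
import Relation.Binary.Reasoning.Setoid as SetoidReasoning
open import Relation.Nullary using (¬_; yes; no; contradiction)
open import Algebra.Properties.Semiring.Sum (CommutativeRing.semiring ℚP.+-*-commutativeRing)
  using (sum; sum-syntax; sum-cong-≗; ∑-distrib-+; ∑-comm; *-distribˡ-sum; *-distribʳ-sum)

n≤2^⌈log2⌉n : ∀ n (rec : Acc _<_ n) → n ≤ 2 ^ ⌈log2⌉ n rec
n≤2^⌈log2⌉n 0 _ = z≤n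
n≤2^⌈log2⌉n 1 _ = ℕP.≤-refl
n≤2^⌈log2⌉n (suc (suc n)) (acc rs) = begin
  2 ℕ.+ n                         ≤⟨ ℕP.+-monoʳ-≤ 2 n≤h+h ⟩
  2 ℕ.+ (h ℕ.+ h)                 ≡⟨ ring h ⟩
  2 ℕ.* suc h                     ≤⟨ ℕP.*-monoʳ-≤ 2 (n≤2^⌈log2⌉n (suc h) _) ⟩
  2 ℕ.* 2 ^ ⌈log2⌉ (suc h) _      ∎
  where
  open ℕP.≤-Reasoning
  h = ℕ.⌈ n /2⌉
  n≤h+h : n ≤ h ℕ.+ h
  n≤h+h = ℕP.≤-trans (ℕP.≤-reflexive (sym (ℕP.⌊n/2⌋+⌈n/2⌉≡n n))) (ℕP.+-monoˡ-≤ h (ℕP.⌊n/2⌋≤⌈n/2⌉ n))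
  ring : ∀ h → 2 ℕ.+ (h ℕ.+ h) ≡ 2 ℕ.* suc h
  ring = ℕ-Tactic.solve-∀

⌈log₂n^k⌉≤k*⌈log₂n⌉ : ∀ n k → ⌈log₂ (n ^ k) ⌉ ≤ k ℕ.* ⌈log₂ n ⌉
⌈log₂n^k⌉≤k*⌈log₂n⌉ n k = begin
  ⌈log₂ (n ^ k) ⌉         ≤⟨ ⌈log₂⌉-mono-≤ (ℕP.^-monoˡ-≤ k (n≤2^⌈log2⌉n n _)) ⟩
  ⌈log₂ (2 ^ t) ^ k ⌉     ≡⟨ cong ⌈log₂_⌉ (ℕP.^-*-assoc 2 t k) ⟩
  ⌈log₂ 2 ^ (t ℕ.* k) ⌉   ≡⟨ ⌈log₂2^n⌉≡n (t ℕ.* k) ⟩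
  t ℕ.* k                 ≡⟨ ℕP.*-comm t k ⟩
  k ℕ.* t                 ∎
  where
  open ℕP.≤-Reasoning
  t = ⌈log₂ n ⌉

RES-row-≤ : ∀ {n K} (R : Mat 1 n) → (∀ j → RESℚ (R zero j) ≤ K) → RES R ≤ K
RES-row-≤ {zero}  R bounded = z≤n
RES-row-≤ {suc n} R bounded = ℕP.⊔-lub
  (ℕP.⊔-lub (bounded zero) (ℕP.m⊔n≤o⇒m≤o _ 0 (RES-row-≤ (λ i j → R i (suc j)) (bounded ∘ suc))))
  z≤n

RES-≤ : ∀ {m n K} (A : Mat m n) → (∀ i j → RESℚ (A i j) ≤ K) → RES A ≤ K
RES-≤ {zero}  A bounded = z≤n
RES-≤ {suc m} A bounded = ℕP.⊔-lub
  (ℕP.m⊔n≤o⇒m≤o _ 0 (RES-row-≤ (λ _ → A zero) (bounded zero)))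
  (RES-≤ (λ i → A (suc i)) (λ i → bounded (suc i)))

-- x ≲ p ·W^ k bounds an integer polynomial of degree k with coefficient sum p
-- in quantities of absolute value at most W.
module SizeBound (W : ℕ) .{{_ : NonZero W}} where

  infix 4 _≲_·W^_

  record _≲_·W^_ (x : ℤ) (p k : ℕ) : Set where
    constructor bound
    field ∣x∣≤ : ∣ x ∣ ≤ p ℕ.* W ^ k

  open _≲_·W^_ public

  ≲-atom : ∀ {x} → ∣ x ∣ ≤ W → x ≲ 1 ·W^ 1
  ≲-atom ∣x∣≤W = bound (ℕP.≤-trans ∣x∣≤W (ℕP.≤-reflexive (sym (trans (ℕP.*-identityˡ _) (ℕP.*-identityʳ W)))))

  ≲-const : ∀ k → + k ≲ k ·W^ 0
  ≲-const k = bound (ℕP.≤-reflexive (sym (ℕP.*-identityʳ k)))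

  ≲-raise : ∀ {x p i k} → i ≤ k → x ≲ p ·W^ i → x ≲ p ·W^ k
  ≲-raise {p = p} i≤k (bound ∣x∣≤) = bound (ℕP.≤-trans ∣x∣≤ (ℕP.*-monoʳ-≤ p (ℕP.^-monoʳ-≤ W i≤k)))

  ≲-weaken : ∀ {x p q k} → p ≤ q → x ≲ p ·W^ k → x ≲ q ·W^ k
  ≲-weaken {k = k} p≤q (bound ∣x∣≤) = bound (ℕP.≤-trans ∣x∣≤ (ℕP.*-monoˡ-≤ (W ^ k) p≤q))

  ≲-neg : ∀ {x p k} → x ≲ p ·W^ k → ℤ.- x ≲ p ·W^ k
  ≲-neg {x} (bound ∣x∣≤) = bound (subst (_≤ _) (sym (ℤP.∣-i∣≡∣i∣ x)) ∣x∣≤)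

  ≲-* : ∀ {x y p q i j} → x ≲ p ·W^ i → y ≲ q ·W^ j → x ℤ.* y ≲ p ℕ.* q ·W^ (i ℕ.+ j)
  ≲-* {x} {y} {p} {q} {i} {j} (bound ∣x∣≤) (bound ∣y∣≤) = bound (begin
    ∣ x ℤ.* y ∣                     ≡⟨ ℤP.abs-* x y ⟩
    ∣ x ∣ ℕ.* ∣ y ∣                 ≤⟨ ℕP.*-mono-≤ ∣x∣≤ ∣y∣≤ ⟩
    p ℕ.* W ^ i ℕ.* (q ℕ.* W ^ j)   ≡⟨ ring p q (W ^ i) (W ^ j) ⟩
    p ℕ.* q ℕ.* (W ^ i ℕ.* W ^ j)   ≡⟨ cong (p ℕ.* q ℕ.*_) (ℕP.^-distribˡ-+-* W i j) ⟨
    p ℕ.* q ℕ.* W ^ (i ℕ.+ j)       ∎)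
    where
    open ℕP.≤-Reasoning
    ring : ∀ p q a b → p ℕ.* a ℕ.* (q ℕ.* b) ≡ p ℕ.* q ℕ.* (a ℕ.* b)
    ring = ℕ-Tactic.solve-∀

  ≲-+ : ∀ {x y p q i j} → x ≲ p ·W^ i → y ≲ q ·W^ j → x ℤ.+ y ≲ p ℕ.+ q ·W^ (i ⊔ j)
  ≲-+ {x} {y} {p} {q} {i} {j} x≲ y≲ = bound (begin
    ∣ x ℤ.+ y ∣                               ≤⟨ ℤP.∣i+j∣≤∣i∣+∣j∣ x y ⟩
    ∣ x ∣ ℕ.+ ∣ y ∣                           ≤⟨ ℕP.+-mono-≤ (∣x∣≤ (≲-raise (ℕP.m≤m⊔n i j) x≲)) (∣x∣≤ (≲-raise (ℕP.m≤n⊔m i j) y≲)) ⟩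
    p ℕ.* W ^ (i ⊔ j) ℕ.+ q ℕ.* W ^ (i ⊔ j)   ≡⟨ ℕP.*-distribʳ-+ (W ^ (i ⊔ j)) p q ⟨
    (p ℕ.+ q) ℕ.* W ^ (i ⊔ j)                 ∎)
    where open ℕP.≤-Reasoning

  ≲-6·W^5 : ∀ {x p k} → x ≲ p ·W^ k → {T (p ℕ.≤ᵇ 6)} → {T (k ℕ.≤ᵇ 5)} → x ≲ 6 ·W^ 5
  ≲-6·W^5 {p = p} {k} x≲ {p≤6} {k≤5} = ≲-weaken (ℕP.≤ᵇ⇒≤ p 6 p≤6) (≲-raise (ℕP.≤ᵇ⇒≤ k 5 k≤5) x≲)

6[n*c]^5<n^6 : ∀ {n c} → 6 ℕ.* c ^ 5 < n → 6 ℕ.* (n ℕ.* c) ^ 5 < n ^ 6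
6[n*c]^5<n^6 {n} {c} 6c⁵<n = begin-strict
  6 ℕ.* (n ℕ.* c) ^ 5     ≡⟨ ring n c ⟩
  6 ℕ.* c ^ 5 ℕ.* n ^ 5   <⟨ ℕP.*-monoˡ-< (n ^ 5) 6c⁵<n ⟩
  n ℕ.* n ^ 5             ∎
  where
  open ℕP.≤-Reasoning
  instance
    n≢0 : NonZero n
    n≢0 = ℕ.>-nonZero (ℕP.<-≤-trans (ℕP.0<1+n) 6c⁵<n)
    n⁵≢0 : NonZero (n ^ 5)
    n⁵≢0 = ℕP.m^n≢0 n 5
  ring : ∀ n c → 6 ℕ.* (n ℕ.* c) ^ 5 ≡ 6 ℕ.* c ^ 5 ℕ.* n ^ 5
  ring = solve 2 (λ n c → con 6 :* ((n :* c) :^ 5) := con 6 :* (c :^ 5) :* (n :^ 5)) refl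
    where open ℕ-Solver

fromℕ : ℕ → ℚ
fromℕ n = fromℤ (+ n)

fromℤ-homo-+ : ∀ x y → fromℤ (x ℤ.+ y) ≡ fromℤ x + fromℤ y
fromℤ-homo-+ x y = ℚP.toℚᵘ-injective
  (ℚᵘP.≃-sym (ℚᵘP.≃-trans (ℚP.toℚᵘ-homo-+ (fromℤ x) (fromℤ y)) (ℚᵘ.*≡* (ring x y))))
  where
  ring : ∀ x y → (x ℤ.* + 1 ℤ.+ y ℤ.* + 1) ℤ.* + 1 ≡ (x ℤ.+ y) ℤ.* (+ 1 ℤ.* + 1)
  ring = ℤ-Tactic.solve-∀

fromℤ-homo-* : ∀ x y → fromℤ (x ℤ.* y) ≡ fromℤ x * fromℤ y
fromℤ-homo-* x y = ℚP.toℚᵘ-injective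
  (ℚᵘP.≃-sym (ℚᵘP.≃-trans (ℚP.toℚᵘ-homo-* (fromℤ x) (fromℤ y)) (ℚᵘ.*≡* (ring x y))))
  where
  ring : ∀ x y → x ℤ.* y ℤ.* + 1 ≡ x ℤ.* y ℤ.* (+ 1 ℤ.* + 1)
  ring = ℤ-Tactic.solve-∀

fromℤ-homo‿- : ∀ x → fromℤ (ℤ.- x) ≡ - fromℤ x
fromℤ-homo‿- x = ℚP.toℚᵘ-injective (ℚᵘP.≃-sym (ℚP.toℚᵘ-homo‿- (fromℤ x)))

p*↧ₙp≡↥p : ∀ p → p * fromℕ (↧ₙ p) ≡ fromℤ (↥ p)
p*↧ₙp≡↥p p@(mkℚ a d-1 _) = ℚP.toℚᵘ-injective
  (ℚᵘP.≃-trans (ℚP.toℚᵘ-homo-* p (fromℕ (suc d-1))) (ℚᵘ.*≡* (ring a (+ suc d-1))))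
  where
  ring : ∀ a d → a ℤ.* d ℤ.* + 1 ≡ a ℤ.* (d ℤ.* + 1)
  ring = ℤ-Tactic.solve-∀

p*y≡x⇒↥p*y≡x*↧p : ∀ p x y → p * fromℤ y ≡ fromℤ x → ↥ p ℤ.* y ≡ x ℤ.* ↧ p
p*y≡x⇒↥p*y≡x*↧p p@(mkℚ _ d-1 _) x y py≡x = begin
  ↥ p ℤ.* y                    ≡⟨ ℤP.*-identityʳ _ ⟨
  ↥ p ℤ.* y ℤ.* + 1            ≡⟨ ℚᵘP.drop-*≡* (ℚᵘP.≃-trans (ℚᵘP.≃-sym (ℚP.toℚᵘ-homo-* p (fromℤ y))) (ℚP.toℚᵘ-cong py≡x)) ⟩
  x ℤ.* (+ suc d-1 ℤ.* + 1)    ≡⟨ cong (x ℤ.*_) (ℤP.*-identityʳ (+ suc d-1)) ⟩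
  x ℤ.* ↧ p                    ∎
  where open ≡-Reasoning

p*y≡x⇒∣↥p∣≤∣x∣×↧ₙp≤∣y∣ : ∀ p x y → p * fromℤ y ≡ fromℤ x → y ≢ 0ℤ → ∣ ↥ p ∣ ≤ ∣ x ∣ × ↧ₙ p ≤ ∣ y ∣
p*y≡x⇒∣↥p∣≤∣x∣×↧ₙp≤∣y∣ p@(mkℚ a d-1 coprime) x y py≡x y≢0 = ∣a∣≤∣x∣ , d≤∣y∣
  where
  instance
    ∣y∣≢0 : NonZero ∣ y ∣
    ∣y∣≢0 = ℕ.≢-nonZero (y≢0 ∘ ℤP.∣i∣≡0⇒i≡0)
  cross : ∣ a ∣ ℕ.* ∣ y ∣ ≡ ∣ x ∣ ℕ.* suc d-1
  cross = trans (sym (ℤP.abs-* a y)) (trans (cong ∣_∣ (p*y≡x⇒↥p*y≡x*↧p p x y py≡x)) (ℤP.abs-* x (↧ p)))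
  d≤∣y∣ : suc d-1 ≤ ∣ y ∣
  d≤∣y∣ = ∣⇒≤ (coprime-divisor (Coprime.sym (Coprime.recompute coprime)) (divides (∣ x ∣) cross))
  ∣a∣≤∣x∣ : ∣ a ∣ ≤ ∣ x ∣
  ∣a∣≤∣x∣ = ℕP.*-cancelʳ-≤ (∣ a ∣) (∣ x ∣) (∣ y ∣) (ℕP.≤-trans (ℕP.≤-reflexive cross) (ℕP.*-monoʳ-≤ (∣ x ∣) d≤∣y∣))

RESℚ-≤ : ∀ q x y X → q * fromℤ y ≡ fromℤ x → y ≢ 0ℤ → ∣ x ∣ < X → ∣ y ∣ < X → RESℚ q ≤ ⌈log₂ X ⌉
RESℚ-≤ q x y X qy≡x y≢0 ∣x∣<X ∣y∣<X with p*y≡x⇒∣↥p∣≤∣x∣×↧ₙp≤∣y∣ q x y qy≡x y≢0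
... | ∣↥q∣≤∣x∣ , ↧ₙq≤∣y∣ = ℕP.⊔-lub (⌈log₂⌉-mono-≤ ∣↥q+1∣≤X) (⌈log₂⌉-mono-≤ (ℕP.<-≤-trans (s≤s ↧ₙq≤∣y∣) ∣y∣<X))
  where
  ∣↥q+1∣≤X : ∣ ↥ q ℤ.+ ℤ.1ℤ ∣ ≤ X
  ∣↥q+1∣≤X = begin
    ∣ ↥ q ℤ.+ ℤ.1ℤ ∣   ≤⟨ ℤP.∣i+j∣≤∣i∣+∣j∣ (↥ q) ℤ.1ℤ ⟩
    ∣ ↥ q ∣ ℕ.+ 1      ≤⟨ ℕP.+-monoˡ-≤ 1 ∣↥q∣≤∣x∣ ⟩
    ∣ x ∣ ℕ.+ 1        ≡⟨ ℕP.+-comm ∣ x ∣ 1 ⟩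
    suc ∣ x ∣          ≤⟨ ∣x∣<X ⟩
    X                  ∎
    where open ℕP.≤-Reasoning

Σℚ≡sum : ∀ k (f : Fin k → ℚ) → Σℚ k f ≡ sum f
Σℚ≡sum zero    f = refl
Σℚ≡sum (suc k) f = cong (λ s → f zero + s) (Σℚ≡sum k (f ∘ suc))

⊗-≡-∑ : ∀ {m k n} (A : Mat m k) (B : Mat k n) i j → (A ⊗ B) i j ≡ ∑[ l < k ] (A i l * B l j)
⊗-≡-∑ {k = k} A B i j = Σℚ≡sum k _

_ᵀ : ∀ {m n} → Mat m n → Mat n m
_ᵀ = transpose

infixl 8 _ᵀ

≐-refl : ∀ {m n} {A : Mat m n} → A ≐ A
≐-refl _ _ = refl

≐-sym : ∀ {m n} {A B : Mat m n} → A ≐ B → B ≐ A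
≐-sym A≐B i j = sym (A≐B i j)

≐-trans : ∀ {m n} {A B C : Mat m n} → A ≐ B → B ≐ C → A ≐ C
≐-trans A≐B B≐C i j = trans (A≐B i j) (B≐C i j)

≐-setoid : ℕ → ℕ → Setoid _ _
≐-setoid m n = record
  { Carrier       = Mat m n
  ; _≈_           = _≐_
  ; isEquivalence = record { refl = ≐-refl ; sym = ≐-sym ; trans = ≐-trans }
  }

module ≐-Reasoning {m n} = SetoidReasoning (≐-setoid m n)

⊗-cong : ∀ {m k n} {A A′ : Mat m k} {B B′ : Mat k n} → A ≐ A′ → B ≐ B′ → A ⊗ B ≐ A′ ⊗ B′
⊗-cong {A = A} {A′} {B} {B′} A≐A′ B≐B′ i j = begin
  (A ⊗ B) i j                       ≡⟨ ⊗-≡-∑ A B i j ⟩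
  ∑[ l < _ ] (A i l * B l j)        ≡⟨ sum-cong-≗ (λ l → cong₂ _*_ (A≐A′ i l) (B≐B′ l j)) ⟩
  ∑[ l < _ ] (A′ i l * B′ l j)      ≡⟨ ⊗-≡-∑ A′ B′ i j ⟨
  (A′ ⊗ B′) i j                     ∎
  where open ≡-Reasoning

⊗-congˡ : ∀ {m k n} (A : Mat m k) {B B′ : Mat k n} → B ≐ B′ → A ⊗ B ≐ A ⊗ B′
⊗-congˡ A = ⊗-cong {A = A} ≐-refl

⊗-congʳ : ∀ {m k n} (B : Mat k n) {A A′ : Mat m k} → A ≐ A′ → A ⊗ B ≐ A′ ⊗ B
⊗-congʳ B A≐A′ = ⊗-cong {B = B} A≐A′ ≐-refl

ᵀ-cong : ∀ {m n} {A B : Mat m n} → A ≐ B → A ᵀ ≐ B ᵀ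
ᵀ-cong A≐B i j = A≐B j i

⊗-assoc : ∀ {m k l n} (A : Mat m k) (B : Mat k l) (C : Mat l n) → A ⊗ B ⊗ C ≐ A ⊗ (B ⊗ C)
⊗-assoc {k = k} {l} A B C i j = begin
  (A ⊗ B ⊗ C) i j                                   ≡⟨ ⊗-≡-∑ (A ⊗ B) C i j ⟩
  ∑[ q < l ] ((A ⊗ B) i q * C q j)                  ≡⟨ sum-cong-≗ (λ q → cong (_* C q j) (⊗-≡-∑ A B i q)) ⟩
  ∑[ q < l ] (∑[ p < k ] (A i p * B p q) * C q j)   ≡⟨ sum-cong-≗ (λ q → *-distribʳ-sum (C q j) (λ p → A i p * B p q)) ⟩
  ∑[ q < l ] ∑[ p < k ] (A i p * B p q * C q j)     ≡⟨ ∑-comm (λ q p → A i p * B p q * C q j) ⟩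
  ∑[ p < k ] ∑[ q < l ] (A i p * B p q * C q j)     ≡⟨ sum-cong-≗ (λ p → sum-cong-≗ (λ q → ℚP.*-assoc (A i p) (B p q) (C q j))) ⟩
  ∑[ p < k ] ∑[ q < l ] (A i p * (B p q * C q j))   ≡⟨ sum-cong-≗ (λ p → *-distribˡ-sum (A i p) (λ q → B p q * C q j)) ⟨
  ∑[ p < k ] (A i p * ∑[ q < l ] (B p q * C q j))   ≡⟨ sum-cong-≗ (λ p → cong (A i p *_) (⊗-≡-∑ B C p j)) ⟨
  ∑[ p < k ] (A i p * (B ⊗ C) p j)                  ≡⟨ ⊗-≡-∑ A (B ⊗ C) i j ⟨
  (A ⊗ (B ⊗ C)) i j                                 ∎
  where open ≡-Reasoning

ᵀ-⊗ : ∀ {m k n} (A : Mat m k) (B : Mat k n) → (A ⊗ B) ᵀ ≐ B ᵀ ⊗ A ᵀ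
ᵀ-⊗ A B i j = begin
  (A ⊗ B) j i                  ≡⟨ ⊗-≡-∑ A B j i ⟩
  ∑[ l < _ ] (A j l * B l i)   ≡⟨ sum-cong-≗ (λ l → ℚP.*-comm (A j l) (B l i)) ⟩
  ∑[ l < _ ] (B l i * A j l)   ≡⟨ ⊗-≡-∑ (B ᵀ) (A ᵀ) i j ⟨
  (B ᵀ ⊗ A ᵀ) i j              ∎
  where open ≡-Reasoning

module _ {m n} {A : Mat m n} where
  open ≐-Reasoning

  private
    P≐P⊗[Pᵀ⊗Aᵀ] : ∀ {P} → IsPseudoinverse A P → P ≐ P ⊗ (P ᵀ ⊗ A ᵀ)
    P≐P⊗[Pᵀ⊗Aᵀ] {P} (_ , PAP≐P , APᵀ≐AP , _) = begin
      P                 ≈⟨ PAP≐P ⟨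
      P ⊗ A ⊗ P         ≈⟨ ⊗-assoc P A P ⟩
      P ⊗ (A ⊗ P)       ≈⟨ ⊗-congˡ P APᵀ≐AP ⟨
      P ⊗ (A ⊗ P) ᵀ     ≈⟨ ⊗-congˡ P (ᵀ-⊗ A P) ⟩
      P ⊗ (P ᵀ ⊗ A ᵀ)   ∎

    Q≐[Aᵀ⊗Qᵀ]⊗Q : ∀ {Q} → IsPseudoinverse A Q → Q ≐ A ᵀ ⊗ Q ᵀ ⊗ Q
    Q≐[Aᵀ⊗Qᵀ]⊗Q {Q} (_ , QAQ≐Q , _ , QAᵀ≐QA) = begin
      Q                 ≈⟨ QAQ≐Q ⟨
      Q ⊗ A ⊗ Q         ≈⟨ ⊗-congʳ Q QAᵀ≐QA ⟨
      (Q ⊗ A) ᵀ ⊗ Q     ≈⟨ ⊗-congʳ Q (ᵀ-⊗ Q A) ⟩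
      A ᵀ ⊗ Q ᵀ ⊗ Q     ∎

    Aᵀ≐Aᵀ⊗[A⊗Q] : ∀ {Q} → IsPseudoinverse A Q → A ᵀ ≐ A ᵀ ⊗ (A ⊗ Q)
    Aᵀ≐Aᵀ⊗[A⊗Q] {Q} (AQA≐A , _ , AQᵀ≐AQ , _) = begin
      A ᵀ                 ≈⟨ ᵀ-cong AQA≐A ⟨
      (A ⊗ Q ⊗ A) ᵀ       ≈⟨ ᵀ-⊗ (A ⊗ Q) A ⟩
      A ᵀ ⊗ (A ⊗ Q) ᵀ     ≈⟨ ⊗-congˡ (A ᵀ) AQᵀ≐AQ ⟩
      A ᵀ ⊗ (A ⊗ Q)       ∎

    Aᵀ≐[P⊗A]⊗Aᵀ : ∀ {P} → IsPseudoinverse A P → A ᵀ ≐ P ⊗ A ⊗ A ᵀ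
    Aᵀ≐[P⊗A]⊗Aᵀ {P} (APA≐A , _ , _ , PAᵀ≐PA) = begin
      A ᵀ                 ≈⟨ ᵀ-cong APA≐A ⟨
      (A ⊗ P ⊗ A) ᵀ       ≈⟨ ᵀ-cong (⊗-assoc A P A) ⟩
      (A ⊗ (P ⊗ A)) ᵀ     ≈⟨ ᵀ-⊗ A (P ⊗ A) ⟩
      (P ⊗ A) ᵀ ⊗ A ᵀ     ≈⟨ ⊗-congʳ (A ᵀ) PAᵀ≐PA ⟩
      P ⊗ A ⊗ A ᵀ         ∎

  -- Both pseudoinverses are shown equal to P A Q.
  pseudoinverse-unique : ∀ {P Q} → IsPseudoinverse A P → IsPseudoinverse A Q → P ≐ Q
  pseudoinverse-unique {P} {Q} P⁺ Q⁺ = begin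
    P                               ≈⟨ P≐P⊗[Pᵀ⊗Aᵀ] P⁺ ⟩
    P ⊗ (P ᵀ ⊗ A ᵀ)                 ≈⟨ ⊗-congˡ P (⊗-congˡ (P ᵀ) (Aᵀ≐Aᵀ⊗[A⊗Q] Q⁺)) ⟩
    P ⊗ (P ᵀ ⊗ (A ᵀ ⊗ (A ⊗ Q)))     ≈⟨ ⊗-congˡ P (⊗-assoc (P ᵀ) (A ᵀ) (A ⊗ Q)) ⟨
    P ⊗ (P ᵀ ⊗ A ᵀ ⊗ (A ⊗ Q))       ≈⟨ ⊗-assoc P (P ᵀ ⊗ A ᵀ) (A ⊗ Q) ⟨
    P ⊗ (P ᵀ ⊗ A ᵀ) ⊗ (A ⊗ Q)       ≈⟨ ⊗-congʳ (A ⊗ Q) (P≐P⊗[Pᵀ⊗Aᵀ] P⁺) ⟨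
    P ⊗ (A ⊗ Q)                     ≈⟨ ⊗-assoc P A Q ⟨
    P ⊗ A ⊗ Q                       ≈⟨ ⊗-congˡ (P ⊗ A) (Q≐[Aᵀ⊗Qᵀ]⊗Q Q⁺) ⟩
    P ⊗ A ⊗ (A ᵀ ⊗ Q ᵀ ⊗ Q)         ≈⟨ ⊗-congˡ (P ⊗ A) (⊗-assoc (A ᵀ) (Q ᵀ) Q) ⟩
    P ⊗ A ⊗ (A ᵀ ⊗ (Q ᵀ ⊗ Q))       ≈⟨ ⊗-assoc (P ⊗ A) (A ᵀ) (Q ᵀ ⊗ Q) ⟨
    P ⊗ A ⊗ A ᵀ ⊗ (Q ᵀ ⊗ Q)         ≈⟨ ⊗-congʳ (Q ᵀ ⊗ Q) (Aᵀ≐[P⊗A]⊗Aᵀ P⁺) ⟨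
    A ᵀ ⊗ (Q ᵀ ⊗ Q)                 ≈⟨ ⊗-assoc (A ᵀ) (Q ᵀ) Q ⟨
    A ᵀ ⊗ Q ᵀ ⊗ Q                   ≈⟨ Q≐[Aᵀ⊗Qᵀ]⊗Q Q⁺ ⟨
    Q                               ∎

𝟙 : Bool → ℚ
𝟙 true  = 1ℚ
𝟙 false = 0ℚ

𝟙-true : ∀ {b} → T b → 𝟙 b ≡ 1ℚ
𝟙-true {true} _ = refl

𝟙-false : ∀ {b} → ¬ T b → 𝟙 b ≡ 0ℚ
𝟙-false {true}  ¬t = contradiction _ ¬t
𝟙-false {false} _  = refl

δ : ℕ → ℕ → ℚ
δ a b = 𝟙 (a ℕ.≡ᵇ b)

𝟙[_<_] : ℕ → ℕ → ℚ
𝟙[ a < k ] = 𝟙 (a ℕ.<ᵇ k)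

δ-refl : ∀ a → δ a a ≡ 1ℚ
δ-refl a = 𝟙-true (ℕP.≡⇒≡ᵇ a a refl)

δ-≢ : ∀ {a b} → a ≢ b → δ a b ≡ 0ℚ
δ-≢ {a} {b} a≢b = 𝟙-false (a≢b ∘ ℕP.≡ᵇ⇒≡ a b)

δ-sym : ∀ a b → δ a b ≡ δ b a
δ-sym zero    zero    = refl
δ-sym zero    (suc b) = refl
δ-sym (suc a) zero    = refl
δ-sym (suc a) (suc b) = δ-sym a b

𝟙[<]-< : ∀ {a k} → a < k → 𝟙[ a < k ] ≡ 1ℚ
𝟙[<]-< = 𝟙-true ∘ ℕP.<⇒<ᵇ

𝟙[<]-≥ : ∀ {a k} → k ≤ a → 𝟙[ a < k ] ≡ 0ℚ
𝟙[<]-≥ {a} {k} k≤a = 𝟙-false (ℕP.≤⇒≯ k≤a ∘ ℕP.<ᵇ⇒< a k)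

Iₘₙ≡δ : ∀ m n (i : Fin m) (j : Fin n) → Iₘₙ m n i j ≡ δ (toℕ i) (toℕ j)
Iₘₙ≡δ m n i j with toℕ i ℕP.≟ toℕ j
... | yes i≡j = sym (trans (cong (λ a → δ a (toℕ j)) i≡j) (δ-refl (toℕ j)))
... | no  i≢j = sym (δ-≢ i≢j)

∑-const : ∀ k c → ∑[ l < k ] c ≡ fromℕ k * c
∑-const zero    c = sym (ℚP.*-zeroˡ c)
∑-const (suc k) c = begin
  c + ∑[ l < k ] c       ≡⟨ cong (λ s → c + s) (∑-const k c) ⟩
  c + fromℕ k * c        ≡⟨ solve 2 (λ c k → c :+ k :* c := (con 1ℚ :+ k) :* c) refl c (fromℕ k) ⟩
  (1ℚ + fromℕ k) * c     ≡⟨ cong (_* c) (fromℤ-homo-+ (+ 1) (+ k)) ⟨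
  fromℕ (suc k) * c      ∎
  where
  open ≡-Reasoning
  open ℚ-Solver

∑-0* : ∀ k (f : Fin k → ℚ) → ∑[ l < k ] (0ℚ * f l) ≡ 0ℚ
∑-0* k f = trans (sym (*-distribˡ-sum 0ℚ f)) (ℚP.*-zeroˡ (sum f))

∑-δ : ∀ k a (f : ℕ → ℚ) → ∑[ l < k ] (δ a (toℕ l) * f (toℕ l)) ≡ 𝟙[ a < k ] * f a
∑-δ zero    a       f = sym (ℚP.*-zeroˡ (f a))
∑-δ (suc k) zero    f = trans (cong (λ s → 1ℚ * f 0 + s) (∑-0* k (f ∘ suc ∘ toℕ))) (ℚP.+-identityʳ _)
∑-δ (suc k) (suc a) f = trans (cong (_+ ∑[ l < k ] (δ a (toℕ l) * f (suc (toℕ l)))) (ℚP.*-zeroˡ (f 0)))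
                          (trans (ℚP.+-identityˡ _) (∑-δ k a (f ∘ suc)))

∑-δ-Fin : ∀ k (i : Fin k) (f : Fin k → ℚ) → ∑[ l < k ] (δ (toℕ i) (toℕ l) * f l) ≡ f i
∑-δ-Fin (suc k) zero    f = trans (cong (λ s → 1ℚ * f zero + s) (∑-0* k (f ∘ suc))) (trans (ℚP.+-identityʳ _) (ℚP.*-identityˡ _))
∑-δ-Fin (suc k) (suc i) f = trans (cong (_+ ∑[ l < k ] (δ (toℕ i) (toℕ l) * f (suc l))) (ℚP.*-zeroˡ (f zero)))
                              (trans (ℚP.+-identityˡ _) (∑-δ-Fin k i (f ∘ suc)))

infix 6 _J+_I

_J+_I : ℚ → ℚ → ∀ {r c} → Mat r c
(x J+ y I) i j = x + y * δ (toℕ i) (toℕ j)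

J+I-cong : ∀ {r c x x′ y y′} → x ≡ x′ → y ≡ y′ → (x J+ y I) ≐ (x′ J+ y′ I) {r} {c}
J+I-cong refl refl _ _ = refl

J+I-symmetric : ∀ {r c} x y → ((x J+ y I) {r} {c}) ᵀ ≐ x J+ y I
J+I-symmetric x y i j = cong (λ d → x + y * d) (δ-sym (toℕ j) (toℕ i))

≐J+I⇒symmetric : ∀ {k} {X : Mat k k} x y → X ≐ x J+ y I → X ᵀ ≐ X
≐J+I⇒symmetric x y X≐ = ≐-trans (ᵀ-cong X≐) (≐-trans (J+I-symmetric x y) (≐-sym X≐))

Bmat≐J+I : ∀ ε m n → Bmat ε m n ≐ 1ℚ J+ ε I
Bmat≐J+I ε m n i j = cong (λ d → 1ℚ + ε * d) (Iₘₙ≡δ m n i j)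

J+I-⊗-J+I : ∀ {r k c} x y z w (i : Fin r) (j : Fin c) → let a = toℕ i; b = toℕ j in
  ((x J+ y I) ⊗ (z J+ w I) {k}) i j ≡
  fromℕ k * (x * z) + x * w * 𝟙[ b < k ] + y * z * 𝟙[ a < k ] + y * w * (𝟙[ a < k ] * δ a b)
J+I-⊗-J+I {k = k} x y z w i j = begin
  ((x J+ y I) ⊗ (z J+ w I) {k}) i j
    ≡⟨ ⊗-≡-∑ {k = k} (x J+ y I) (z J+ w I) i j ⟩
  ∑[ l < k ] ((x + y * δ a (toℕ l)) * (z + w * δ (toℕ l) b))
    ≡⟨ sum-cong-≗ {k} (λ l → expand (δ a (toℕ l)) (δ-sym (toℕ l) b)) ⟩
  ∑[ l < k ] (x * z + x * w * (δ b (toℕ l) * 1ℚ) + y * z * (δ a (toℕ l) * 1ℚ) + y * w * (δ a (toℕ l) * δ b (toℕ l)))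
    ≡⟨ trans (∑-distrib-+ (λ l → t₁ l + t₂ l + t₃ l) t₄) (cong (_+ sum t₄)
         (trans (∑-distrib-+ (λ l → t₁ l + t₂ l) t₃) (cong (_+ sum t₃) (∑-distrib-+ t₁ t₂)))) ⟩
  ∑[ l < k ] (x * z) + ∑[ l < k ] (x * w * (δ b (toℕ l) * 1ℚ))
    + ∑[ l < k ] (y * z * (δ a (toℕ l) * 1ℚ)) + ∑[ l < k ] (y * w * (δ a (toℕ l) * δ b (toℕ l)))
    ≡⟨ cong₂ _+_ (cong₂ _+_ (cong₂ _+_ (∑-const k (x * z)) (∑-δ-scaled (x * w) b (λ _ → 1ℚ)))
                            (∑-δ-scaled (y * z) a (λ _ → 1ℚ)))
                 (∑-δ-scaled (y * w) a (δ b)) ⟩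
  fromℕ k * (x * z) + x * w * (𝟙[ b < k ] * 1ℚ) + y * z * (𝟙[ a < k ] * 1ℚ) + y * w * (𝟙[ a < k ] * δ b a)
    ≡⟨ solve 8 (λ n x y z w p q d →
         n :* (x :* z) :+ x :* w :* (p :* con 1ℚ) :+ y :* z :* (q :* con 1ℚ) :+ y :* w :* (q :* d) :=
         n :* (x :* z) :+ x :* w :* p :+ y :* z :* q :+ y :* w :* (q :* d))
         refl (fromℕ k) x y z w 𝟙[ b < k ] 𝟙[ a < k ] (δ b a) ⟩
  fromℕ k * (x * z) + x * w * 𝟙[ b < k ] + y * z * 𝟙[ a < k ] + y * w * (𝟙[ a < k ] * δ b a)
    ≡⟨ cong (λ d → fromℕ k * (x * z) + x * w * 𝟙[ b < k ] + y * z * 𝟙[ a < k ] + y * w * (𝟙[ a < k ] * d)) (δ-sym b a) ⟩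
  fromℕ k * (x * z) + x * w * 𝟙[ b < k ] + y * z * 𝟙[ a < k ] + y * w * (𝟙[ a < k ] * δ a b) ∎
  where
  open ≡-Reasoning
  open ℚ-Solver
  a = toℕ i
  b = toℕ j
  expand : ∀ {q q′} p → q ≡ q′ → (x + y * p) * (z + w * q) ≡ x * z + x * w * (q′ * 1ℚ) + y * z * (p * 1ℚ) + y * w * (p * q′)
  expand {q′ = q′} p refl = solve 6 (λ x y z w p q → (x :+ y :* p) :* (z :+ w :* q) := x :* z :+ x :* w :* (q :* con 1ℚ) :+ y :* z :* (p :* con 1ℚ) :+ y :* w :* (p :* q)) refl x y z w p q′
  ∑-δ-scaled : ∀ c a′ (f : ℕ → ℚ) → ∑[ l < k ] (c * (δ a′ (toℕ l) * f (toℕ l))) ≡ c * (𝟙[ a′ < k ] * f a′)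
  ∑-δ-scaled c a′ f = trans (sym (*-distribˡ-sum {k} c (λ l → δ a′ (toℕ l) * f (toℕ l)))) (cong (c *_) (∑-δ k a′ f))
  t₁ t₂ t₃ t₄ : Fin k → ℚ
  t₁ l = x * z
  t₂ l = x * w * (δ b (toℕ l) * 1ℚ)
  t₃ l = y * z * (δ a (toℕ l) * 1ℚ)
  t₄ l = y * w * (δ a (toℕ l) * δ b (toℕ l))

J+I-⊗-J+I-closed : ∀ {r k c} x y z w → r ≤ k → c ≤ k →
  (x J+ y I) ⊗ (z J+ w I) {k} ≐ (fromℕ k * (x * z) + x * w + y * z J+ y * w I) {r} {c}
J+I-⊗-J+I-closed {k = k} x y z w r≤k c≤k i j = begin
  ((x J+ y I) ⊗ (z J+ w I) {k}) i j
    ≡⟨ J+I-⊗-J+I {k = k} x y z w i j ⟩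
  fromℕ k * (x * z) + x * w * 𝟙[ b < k ] + y * z * 𝟙[ a < k ] + y * w * (𝟙[ a < k ] * δ a b)
    ≡⟨ cong₂ (λ p q → fromℕ k * (x * z) + x * w * q + y * z * p + y * w * (p * δ a b))
             (𝟙[<]-< (ℕP.<-≤-trans (toℕ<n i) r≤k)) (𝟙[<]-< (ℕP.<-≤-trans (toℕ<n j) c≤k)) ⟩
  fromℕ k * (x * z) + x * w * 1ℚ + y * z * 1ℚ + y * w * (1ℚ * δ a b)
    ≡⟨ solve 6 (λ n x y z w d →
         n :* (x :* z) :+ x :* w :* con 1ℚ :+ y :* z :* con 1ℚ :+ y :* w :* (con 1ℚ :* d) :=
         n :* (x :* z) :+ x :* w :+ y :* z :+ y :* w :* d) refl (fromℕ k) x y z w (δ a b) ⟩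
  fromℕ k * (x * z) + x * w + y * z + y * w * δ a b ∎
  where
  open ≡-Reasoning
  open ℚ-Solver
  a = toℕ i
  b = toℕ j

J-⊗-J : ∀ {r k c} x z → (x J+ 0ℚ I) ⊗ (z J+ 0ℚ I) {k} ≐ (fromℕ k * (x * z) J+ 0ℚ I) {r} {c}
J-⊗-J {k = k} x z i j = trans (J+I-⊗-J+I {k = k} x 0ℚ z 0ℚ i j)
  (solve 6 (λ n x z p q d →
     n :* (x :* z) :+ x :* con 0ℚ :* p :+ con 0ℚ :* z :* q :+ con 0ℚ :* con 0ℚ :* (q :* d) :=
     n :* (x :* z) :+ con 0ℚ :* d) refl (fromℕ k) x z 𝟙[ toℕ j < k ] 𝟙[ toℕ i < k ] (δ (toℕ i) (toℕ j)))
  where open ℚ-Solver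

Id : ∀ {k} → Mat k k
Id = 0ℚ J+ 1ℚ I

Id-entry : ∀ a b → 0ℚ + 1ℚ * δ a b ≡ δ a b
Id-entry a b = trans (ℚP.+-identityˡ _) (ℚP.*-identityˡ _)

Id-⊗ : ∀ {k n} (X : Mat k n) → Id ⊗ X ≐ X
Id-⊗ {k} X i j = begin
  (Id ⊗ X) i j                                  ≡⟨ ⊗-≡-∑ Id X i j ⟩
  ∑[ l < k ] ((0ℚ + 1ℚ * δ (toℕ i) (toℕ l)) * X l j)
    ≡⟨ sum-cong-≗ {k} (λ l → cong (_* X l j) (Id-entry (toℕ i) (toℕ l))) ⟩
  ∑[ l < k ] (δ (toℕ i) (toℕ l) * X l j)        ≡⟨ ∑-δ-Fin k i (λ l → X l j) ⟩
  X i j                                         ∎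
  where open ≡-Reasoning

⊗-Id : ∀ {m k} (X : Mat m k) → X ⊗ Id ≐ X
⊗-Id {k = k} X i j = begin
  (X ⊗ Id) i j                                  ≡⟨ ⊗-≡-∑ X Id i j ⟩
  ∑[ l < k ] (X i l * (0ℚ + 1ℚ * δ (toℕ l) (toℕ j)))
    ≡⟨ sum-cong-≗ {k} (λ l → trans (ℚP.*-comm (X i l) _)
                               (cong (_* X i l) (trans (Id-entry (toℕ l) (toℕ j)) (δ-sym (toℕ l) (toℕ j))))) ⟩
  ∑[ l < k ] (δ (toℕ j) (toℕ l) * X i l)        ≡⟨ ∑-δ-Fin k j (X i) ⟩
  X i j                                         ∎
  where open ≡-Reasoning

Gram-inverse⇒pseudoinverse : ∀ {m n} (A : Mat m n) (M : Mat m m) →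
  M ᵀ ≐ M → A ⊗ A ᵀ ⊗ M ≐ Id → IsPseudoinverse A (A ᵀ ⊗ M)
Gram-inverse⇒pseudoinverse A M Mᵀ≐M AAᵀM≐Id = APA≐A , PAP≐P , APᵀ≐AP , PAᵀ≐PA
  where
  open ≐-Reasoning
  P = A ᵀ ⊗ M
  AP≐Id : A ⊗ P ≐ Id
  AP≐Id = ≐-trans (≐-sym (⊗-assoc A (A ᵀ) M)) AAᵀM≐Id
  APA≐A : A ⊗ P ⊗ A ≐ A
  APA≐A = ≐-trans (⊗-congʳ A AP≐Id) (Id-⊗ A)
  PAP≐P : P ⊗ A ⊗ P ≐ P
  PAP≐P = ≐-trans (⊗-assoc P A P) (≐-trans (⊗-congˡ P AP≐Id) (⊗-Id P))
  APᵀ≐AP : (A ⊗ P) ᵀ ≐ A ⊗ P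
  APᵀ≐AP = ≐J+I⇒symmetric 0ℚ 1ℚ AP≐Id
  PAᵀ≐PA : (P ⊗ A) ᵀ ≐ P ⊗ A
  PAᵀ≐PA = begin
    (A ᵀ ⊗ M ⊗ A) ᵀ       ≈⟨ ᵀ-cong (⊗-assoc (A ᵀ) M A) ⟩
    (A ᵀ ⊗ (M ⊗ A)) ᵀ     ≈⟨ ᵀ-⊗ (A ᵀ) (M ⊗ A) ⟩
    (M ⊗ A) ᵀ ⊗ A         ≈⟨ ⊗-congʳ A (ᵀ-⊗ M A) ⟩
    A ᵀ ⊗ M ᵀ ⊗ A         ≈⟨ ⊗-congʳ A (⊗-congˡ (A ᵀ) Mᵀ≐M) ⟩
    A ᵀ ⊗ M ⊗ A           ∎

-- B Bᵀ = g J + ε² I, and D = m g + ε² is its eigenvalue on the all-ones vector.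
g : ℚ → ℕ → ℚ
g ε n = fromℕ n + ε + ε

D : ℚ → ℕ → ℕ → ℚ
D ε m n = fromℕ m * g ε n + ε * ε

B⊗Bᵀ≐ : ∀ ε {m n} → m ≤ n → Bmat ε m n ⊗ Bmat ε m n ᵀ ≐ g ε n J+ ε * ε I
B⊗Bᵀ≐ ε {m} {n} m≤n = begin
  B ⊗ B ᵀ                                         ≈⟨ ⊗-cong (Bmat≐J+I ε m n) (≐-trans (ᵀ-cong (Bmat≐J+I ε m n)) (J+I-symmetric 1ℚ ε)) ⟩
  (1ℚ J+ ε I) ⊗ (1ℚ J+ ε I) {n}                   ≈⟨ J+I-⊗-J+I-closed 1ℚ ε 1ℚ ε m≤n m≤n ⟩
  fromℕ n * (1ℚ * 1ℚ) + 1ℚ * ε + ε * 1ℚ J+ ε * ε I  ≈⟨ J+I-cong {y = ε * ε} (solve 2 (λ n e → n :* (con 1ℚ :* con 1ℚ) :+ con 1ℚ :* e :+ e :* con 1ℚ := n :+ e :+ e) refl (fromℕ n) ε) refl ⟩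
  g ε n J+ ε * ε I                                ∎
  where
  open ≐-Reasoning
  open ℚ-Solver
  B = Bmat ε m n

-- u is chosen so that (g J + ε² I) (u J + v I) = I when v = 1 / ε² and d = 1 / D.
module PseudoinverseOfB (ε : ℚ) {m n : ℕ} (m≤n : m ≤ n) (v d : ℚ)
               (ε²v≡1 : ε * ε * v ≡ 1ℚ) (Dd≡1 : D ε m n * d ≡ 1ℚ) where

  open ℚ-Solver

  u : ℚ
  u = - (g ε n * v * d)

  u*D≡-gv : u * D ε m n ≡ - (g ε n * v)
  u*D≡-gv = begin
    u * D ε m n                    ≡⟨ solve 4 (λ g v d D → :- (g :* v :* d) :* D := :- (g :* v) :* (D :* d)) refl (g ε n) v d (D ε m n) ⟩
    - (g ε n * v) * (D ε m n * d)  ≡⟨ cong (- (g ε n * v) *_) Dd≡1 ⟩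
    - (g ε n * v) * 1ℚ             ≡⟨ ℚP.*-identityʳ _ ⟩
    - (g ε n * v)                  ∎
    where open ≡-Reasoning

  Gram⊗M≐Id : (g ε n J+ ε * ε I) ⊗ (u J+ v I) {m} ≐ Id {m}
  Gram⊗M≐Id = ≐-trans (J+I-⊗-J+I-closed (g ε n) (ε * ε) u v ℕP.≤-refl ℕP.≤-refl) (J+I-cong J-coefficient ε²v≡1)
    where
    J-coefficient : fromℕ m * (g ε n * u) + g ε n * v + ε * ε * u ≡ 0ℚ
    J-coefficient = begin
      fromℕ m * (g ε n * u) + g ε n * v + ε * ε * u
        ≡⟨ solve 5 (λ m g e u v → m :* (g :* u) :+ g :* v :+ e :* e :* u := u :* (m :* g :+ e :* e) :+ g :* v) refl (fromℕ m) (g ε n) ε u v ⟩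
      u * D ε m n + g ε n * v    ≡⟨ cong (_+ g ε n * v) u*D≡-gv ⟩
      - (g ε n * v) + g ε n * v  ≡⟨ ℚP.+-inverseˡ (g ε n * v) ⟩
      0ℚ                         ∎
      where open ≡-Reasoning

  B⁺ : Mat n m
  B⁺ = Bmat ε m n ᵀ ⊗ (u J+ v I)

  B⁺-pseudoinverse : IsPseudoinverse (Bmat ε m n) B⁺
  B⁺-pseudoinverse = Gram-inverse⇒pseudoinverse (Bmat ε m n) (u J+ v I) (J+I-symmetric u v)
    (≐-trans (⊗-congʳ (u J+ v I) (B⊗Bᵀ≐ ε m≤n)) Gram⊗M≐Id)

  α β γ : ℚ
  α = fromℕ m * u + v
  β = ε * u
  γ = ε * v

  B⁺-entry : ∀ i j → B⁺ i j ≡ α + β * 𝟙[ toℕ i < m ] + γ * (𝟙[ toℕ i < m ] * δ (toℕ i) (toℕ j))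
  B⁺-entry i j = begin
    B⁺ i j
      ≡⟨ ⊗-cong {B = u J+ v I} (≐-trans (ᵀ-cong (Bmat≐J+I ε m n)) (J+I-symmetric 1ℚ ε)) ≐-refl i j ⟩
    ((1ℚ J+ ε I) ⊗ (u J+ v I) {m}) i j
      ≡⟨ J+I-⊗-J+I {k = m} 1ℚ ε u v i j ⟩
    fromℕ m * (1ℚ * u) + 1ℚ * v * 𝟙[ toℕ j < m ] + ε * u * p + ε * v * (p * δ (toℕ i) (toℕ j))
      ≡⟨ cong (λ q → fromℕ m * (1ℚ * u) + 1ℚ * v * q + ε * u * p + ε * v * (p * δ (toℕ i) (toℕ j))) (𝟙[<]-< (toℕ<n j)) ⟩
    fromℕ m * (1ℚ * u) + 1ℚ * v * 1ℚ + ε * u * p + ε * v * (p * δ (toℕ i) (toℕ j))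
      ≡⟨ solve 6 (λ m u v e p d → m :* (con 1ℚ :* u) :+ con 1ℚ :* v :* con 1ℚ :+ e :* u :* p :+ e :* v :* (p :* d)
                                := m :* u :+ v :+ e :* u :* p :+ e :* v :* (p :* d)) refl (fromℕ m) u v ε p (δ (toℕ i) (toℕ j)) ⟩
    α + β * p + γ * (p * δ (toℕ i) (toℕ j)) ∎
    where
    open ≡-Reasoning
    p = 𝟙[ toℕ i < m ]

  entry : ℚ → ℚ → ℚ
  entry p s = α + β * p + γ * (p * s)

  B⁺-entries : ∀ i j → B⁺ i j ≡ α ⊎ B⁺ i j ≡ α + β ⊎ B⁺ i j ≡ α + β + γ
  B⁺-entries i j with m ℕP.≤? toℕ i | toℕ i ℕP.≟ toℕ j
  ... | yes m≤i | _       = inj₁ (trans (B⁺-entry i j) (trans (cong (λ p → entry p (δ (toℕ i) (toℕ j))) (𝟙[<]-≥ m≤i))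
      (solve 4 (λ a b c d → a :+ b :* con 0ℚ :+ c :* (con 0ℚ :* d) := a) refl α β γ (δ (toℕ i) (toℕ j)))))
  ... | no m≰i  | no i≢j  = inj₂ (inj₁ (trans (B⁺-entry i j) (trans (cong₂ entry (𝟙[<]-< (ℕP.≰⇒> m≰i)) (δ-≢ i≢j))
      (solve 3 (λ a b c → a :+ b :* con 1ℚ :+ c :* (con 1ℚ :* con 0ℚ) := a :+ b) refl α β γ))))
  ... | no m≰i  | yes i≡j = inj₂ (inj₂ (trans (B⁺-entry i j) (trans (cong₂ entry (𝟙[<]-< (ℕP.≰⇒> m≰i)) (trans (cong (λ a → δ a (toℕ j)) i≡j) (δ-refl (toℕ j))))
      (solve 3 (λ a b c → a :+ b :* con 1ℚ :+ c :* (con 1ℚ :* con 1ℚ) := a :+ b :+ c) refl α β γ))))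

  α*D≡1 : α * D ε m n ≡ 1ℚ
  α*D≡1 = begin
    α * D ε m n                                ≡⟨ solve 4 (λ m u v D → (m :* u :+ v) :* D := m :* (u :* D) :+ v :* D) refl (fromℕ m) u v (D ε m n) ⟩
    fromℕ m * (u * D ε m n) + v * D ε m n      ≡⟨ cong (λ t → fromℕ m * t + v * D ε m n) u*D≡-gv ⟩
    fromℕ m * - (g ε n * v) + v * D ε m n      ≡⟨ solve 4 (λ m g e v → m :* (:- (g :* v)) :+ v :* (m :* g :+ e :* e) := e :* e :* v) refl (fromℕ m) (g ε n) ε v ⟩
    ε * ε * v                                  ≡⟨ ε²v≡1 ⟩
    1ℚ                                         ∎
    where open ≡-Reasoning

  [α+β]*εD≡-[n+ε] : (α + β) * (ε * D ε m n) ≡ - (fromℕ n + ε)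
  [α+β]*εD≡-[n+ε] = begin
    (α + β) * (ε * D ε m n)                        ≡⟨ solve 4 (λ a e u D → (a :+ e :* u) :* (e :* D) := e :* (a :* D) :+ e :* e :* (u :* D)) refl α ε u (D ε m n) ⟩
    ε * (α * D ε m n) + ε * ε * (u * D ε m n)      ≡⟨ cong₂ (λ s t → ε * s + ε * ε * t) α*D≡1 u*D≡-gv ⟩
    ε * 1ℚ + ε * ε * - (g ε n * v)                 ≡⟨ solve 3 (λ e g v → e :* con 1ℚ :+ e :* e :* (:- (g :* v)) := e :- g :* (e :* e :* v)) refl ε (g ε n) v ⟩
    ε - g ε n * (ε * ε * v)                        ≡⟨ cong (λ t → ε - g ε n * t) ε²v≡1 ⟩
    ε - g ε n * 1ℚ                                 ≡⟨ solve 2 (λ n e → e :- (n :+ e :+ e) :* con 1ℚ := :- (n :+ e)) refl (fromℕ n) ε ⟩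
    - (fromℕ n + ε)                                ∎
    where open ≡-Reasoning

  [α+β+γ]*εD≡D-[n+ε] : (α + β + γ) * (ε * D ε m n) ≡ D ε m n - (fromℕ n + ε)
  [α+β+γ]*εD≡D-[n+ε] = begin
    (α + β + γ) * (ε * D ε m n)                        ≡⟨ solve 5 (λ a b e v D → (a :+ b :+ e :* v) :* (e :* D) := (a :+ b) :* (e :* D) :+ e :* e :* v :* D) refl α β ε v (D ε m n) ⟩
    (α + β) * (ε * D ε m n) + ε * ε * v * D ε m n      ≡⟨ cong₂ (λ s t → s + t * D ε m n) [α+β]*εD≡-[n+ε] ε²v≡1 ⟩
    - (fromℕ n + ε) + 1ℚ * D ε m n                     ≡⟨ solve 2 (λ x D → :- x :+ con 1ℚ :* D := D :- x) refl (fromℕ n + ε) (D ε m n) ⟩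
    D ε m n - (fromℕ n + ε)                            ∎
    where open ≡-Reasoning

+N+j≢0 : ∀ N j → ∣ j ∣ < N → + N ℤ.+ j ≢ 0ℤ
+N+j≢0 N j ∣j∣<N N+j≡0 = ℕP.<-irrefl ∣j∣≡N ∣j∣<N
  where
  j≡-N : j ≡ ℤ.- (+ N)
  j≡-N = trans (cancel (+ N) j) (trans (cong (λ t → ℤ.- (+ N) ℤ.+ t) N+j≡0) (ℤP.+-identityʳ _))
    where
    cancel : ∀ i j → j ≡ ℤ.- i ℤ.+ (i ℤ.+ j)
    cancel = ℤ-Tactic.solve-∀
  ∣j∣≡N : ∣ j ∣ ≡ N
  ∣j∣≡N = trans (cong ∣_∣ j≡-N) (ℤP.∣-i∣≡∣i∣ (+ N))

a*a≡∣a∣*∣a∣ : ∀ a → a ℤ.* a ≡ + ∣ a ∣ ℤ.* + ∣ a ∣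
a*a≡∣a∣*∣a∣ (+ k)     = refl
a*a≡∣a∣*∣a∣ -[1+ k ] = refl

-- b² D for ε = a / b
Eℤ : ℕ → ℕ → ℤ → ℕ → ℤ
Eℤ m n a b = + m ℤ.* (+ n ℤ.* (+ b ℤ.* + b) ℤ.+ + 2 ℤ.* + b ℤ.* a) ℤ.+ a ℤ.* a

Eℤ≢0 : ∀ m n a b .{{_ : NonZero m}} .{{_ : NonZero b}} → 2 ℕ.* ∣ a ∣ < n → Eℤ m n a b ≢ 0ℤ
Eℤ≢0 m n a b 2∣a∣<n = subst (_≢ 0ℤ) (sym E≡N+j) (+N+j≢0 N j ∣j∣<N)
  where
  N = m ℕ.* n ℕ.* (b ℕ.* b) ℕ.+ ∣ a ∣ ℕ.* ∣ a ∣
  j = + 2 ℤ.* + m ℤ.* + b ℤ.* a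
  E≡N+j : Eℤ m n a b ≡ + N ℤ.+ j
  E≡N+j = begin
    Eℤ m n a b                                                        ≡⟨ ring (+ m) (+ n) (+ b) a ⟩
    + m ℤ.* + n ℤ.* (+ b ℤ.* + b) ℤ.+ a ℤ.* a ℤ.+ j                   ≡⟨ cong (λ t → + m ℤ.* + n ℤ.* (+ b ℤ.* + b) ℤ.+ t ℤ.+ j) (a*a≡∣a∣*∣a∣ a) ⟩
    + m ℤ.* + n ℤ.* (+ b ℤ.* + b) ℤ.+ + ∣ a ∣ ℤ.* + ∣ a ∣ ℤ.+ j       ≡⟨ cong (ℤ._+ j) +N≡ ⟨
    + N ℤ.+ j                                                         ∎
    where
    open ≡-Reasoning
    ring : ∀ m n b a → m ℤ.* (n ℤ.* (b ℤ.* b) ℤ.+ + 2 ℤ.* b ℤ.* a) ℤ.+ a ℤ.* a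
                       ≡ m ℤ.* n ℤ.* (b ℤ.* b) ℤ.+ a ℤ.* a ℤ.+ + 2 ℤ.* m ℤ.* b ℤ.* a
    ring = ℤ-Tactic.solve-∀
    +N≡ : + N ≡ + m ℤ.* + n ℤ.* (+ b ℤ.* + b) ℤ.+ + ∣ a ∣ ℤ.* + ∣ a ∣
    +N≡ = trans (ℤP.pos-+ (m ℕ.* n ℕ.* (b ℕ.* b)) (∣ a ∣ ℕ.* ∣ a ∣))
      (cong₂ ℤ._+_ (trans (ℤP.pos-* (m ℕ.* n) (b ℕ.* b)) (cong₂ ℤ._*_ (ℤP.pos-* m n) (ℤP.pos-* b b)))
                   (ℤP.pos-* ∣ a ∣ ∣ a ∣))
  instance
    mb≢0 : NonZero (m ℕ.* b)
    mb≢0 = ℕP.m*n≢0 m b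
  ∣j∣<N : ∣ j ∣ < N
  ∣j∣<N = begin-strict
    ∣ j ∣                             ≡⟨ trans (ℤP.abs-* (+ 2 ℤ.* + m ℤ.* + b) a) (cong (ℕ._* ∣ a ∣) (trans (ℤP.abs-* (+ 2 ℤ.* + m) (+ b)) (cong (ℕ._* b) (ℤP.abs-* (+ 2) (+ m))))) ⟩
    2 ℕ.* m ℕ.* b ℕ.* ∣ a ∣           ≡⟨ ring₁ m b ∣ a ∣ ⟩
    m ℕ.* b ℕ.* (2 ℕ.* ∣ a ∣)         <⟨ ℕP.*-monoʳ-< (m ℕ.* b) (ℕP.<-≤-trans 2∣a∣<n (ℕP.m≤m*n n b)) ⟩
    m ℕ.* b ℕ.* (n ℕ.* b)             ≡⟨ ring₂ m n b ⟩
    m ℕ.* n ℕ.* (b ℕ.* b)             ≤⟨ ℕP.m≤m+n _ _ ⟩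
    N                                 ∎
    where
    open ℕP.≤-Reasoning
    ring₁ : ∀ m b a → 2 ℕ.* m ℕ.* b ℕ.* a ≡ m ℕ.* b ℕ.* (2 ℕ.* a)
    ring₁ = ℕ-Tactic.solve-∀
    ring₂ : ∀ m n b → m ℕ.* b ℕ.* (n ℕ.* b) ≡ m ℕ.* n ℕ.* (b ℕ.* b)
    ring₂ = ℕ-Tactic.solve-∀

fraction-by-scaling : ∀ {X x y} q Y s → q * Y ≡ X → Y * s ≡ fromℤ y → X * s ≡ fromℤ x → q * fromℤ y ≡ fromℤ x
fraction-by-scaling {X} {x} {y} q Y s qY≡X Ys≡y Xs≡x = begin
  q * fromℤ y    ≡⟨ cong (q *_) Ys≡y ⟨
  q * (Y * s)    ≡⟨ ℚP.*-assoc q Y s ⟨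
  q * Y * s      ≡⟨ cong (_* s) qY≡X ⟩
  X * s          ≡⟨ Xs≡x ⟩
  fromℤ x        ∎
  where open ≡-Reasoning

module Fractions (ε : ℚ) {m n : ℕ} where

  open ℚ-Solver

  a = ↥ ε
  b = ↧ₙ ε
  E = Eℤ m n a b
  F = (+ n ℤ.* + b ℤ.+ a) ℤ.* (+ b ℤ.* + b)

  εb≡a : ε * fromℕ b ≡ fromℤ a
  εb≡a = p*↧ₙp≡↥p ε

  fromℤ-b² : fromℤ (+ b ℤ.* + b) ≡ fromℕ b * fromℕ b
  fromℤ-b² = fromℤ-homo-* (+ b) (+ b)

  fromℤ-E : fromℤ E ≡ D ε m n * (fromℕ b * fromℕ b)
  fromℤ-E = begin
    fromℤ E
      ≡⟨ trans (fromℤ-homo-+ (+ m ℤ.* X) (a ℤ.* a)) (cong₂ _+_ (trans (fromℤ-homo-* (+ m) X)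
           (cong (fromℕ m *_) (trans (fromℤ-homo-+ (+ n ℤ.* (+ b ℤ.* + b)) (+ 2 ℤ.* + b ℤ.* a))
             (cong₂ _+_ (trans (fromℤ-homo-* (+ n) (+ b ℤ.* + b)) (cong (fromℕ n *_) fromℤ-b²))
                        (trans (fromℤ-homo-* (+ 2 ℤ.* + b) a) (cong (_* fromℤ a) (fromℤ-homo-* (+ 2) (+ b))))))))
           (fromℤ-homo-* a a)) ⟩
    fromℕ m * (fromℕ n * (fromℕ b * fromℕ b) + fromℕ 2 * fromℕ b * fromℤ a) + fromℤ a * fromℤ a
      ≡⟨ cong (λ t → fromℕ m * (fromℕ n * (fromℕ b * fromℕ b) + fromℕ 2 * fromℕ b * t) + t * t) εb≡a ⟨
    fromℕ m * (fromℕ n * (fromℕ b * fromℕ b) + fromℕ 2 * fromℕ b * (ε * fromℕ b)) + ε * fromℕ b * (ε * fromℕ b)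
      ≡⟨ solve 4 (λ m n b e → m :* (n :* (b :* b) :+ con (fromℕ 2) :* b :* (e :* b)) :+ e :* b :* (e :* b)
                            := (m :* (n :+ e :+ e) :+ e :* e) :* (b :* b)) refl (fromℕ m) (fromℕ n) (fromℕ b) ε ⟩
    D ε m n * (fromℕ b * fromℕ b) ∎
    where
    open ≡-Reasoning
    X = + n ℤ.* (+ b ℤ.* + b) ℤ.+ + 2 ℤ.* + b ℤ.* a

  fromℤ-F : fromℤ F ≡ (fromℕ n * fromℕ b + ε * fromℕ b) * (fromℕ b * fromℕ b)
  fromℤ-F = trans (fromℤ-homo-* (+ n ℤ.* + b ℤ.+ a) (+ b ℤ.* + b))
    (cong₂ _*_ (trans (fromℤ-homo-+ (+ n ℤ.* + b) a) (cong₂ _+_ (fromℤ-homo-* (+ n) (+ b)) (sym εb≡a))) fromℤ-b²)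

  εD*b³≡aE : ε * D ε m n * (fromℕ b * (fromℕ b * fromℕ b)) ≡ fromℤ (a ℤ.* E)
  εD*b³≡aE = begin
    ε * D ε m n * (fromℕ b * (fromℕ b * fromℕ b))   ≡⟨ solve 3 (λ e D b → e :* D :* (b :* (b :* b)) := e :* b :* (D :* (b :* b))) refl ε (D ε m n) (fromℕ b) ⟩
    ε * fromℕ b * (D ε m n * (fromℕ b * fromℕ b))   ≡⟨ cong₂ _*_ εb≡a (sym fromℤ-E) ⟩
    fromℤ a * fromℤ E                               ≡⟨ fromℤ-homo-* a E ⟨
    fromℤ (a ℤ.* E)                                 ∎
    where open ≡-Reasoning

  module Entries (m≤n : m ≤ n) (v d : ℚ) (ε²v≡1 : ε * ε * v ≡ 1ℚ) (Dd≡1 : D ε m n * d ≡ 1ℚ) where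

    open PseudoinverseOfB ε m≤n v d ε²v≡1 Dd≡1 public

    α-fraction : α * fromℤ E ≡ fromℤ (+ b ℤ.* + b)
    α-fraction = fraction-by-scaling α (D ε m n) (fromℕ b * fromℕ b) α*D≡1 (sym fromℤ-E)
      (trans (ℚP.*-identityˡ _) (sym fromℤ-b²))

    [α+β]-fraction : (α + β) * fromℤ (a ℤ.* E) ≡ fromℤ (ℤ.- F)
    [α+β]-fraction = fraction-by-scaling (α + β) (ε * D ε m n) (fromℕ b * (fromℕ b * fromℕ b)) [α+β]*εD≡-[n+ε] εD*b³≡aE (begin
      - (fromℕ n + ε) * (fromℕ b * (fromℕ b * fromℕ b))                ≡⟨ solve 3 (λ n e b → :- (n :+ e) :* (b :* (b :* b)) := :- ((n :* b :+ e :* b) :* (b :* b))) refl (fromℕ n) ε (fromℕ b) ⟩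
      - ((fromℕ n * fromℕ b + ε * fromℕ b) * (fromℕ b * fromℕ b))     ≡⟨ cong -_ fromℤ-F ⟨
      - fromℤ F                                                        ≡⟨ fromℤ-homo‿- F ⟨
      fromℤ (ℤ.- F)                                                    ∎)
      where open ≡-Reasoning

    [α+β+γ]-fraction : (α + β + γ) * fromℤ (a ℤ.* E) ≡ fromℤ (+ b ℤ.* E ℤ.- F)
    [α+β+γ]-fraction = fraction-by-scaling (α + β + γ) (ε * D ε m n) (fromℕ b * (fromℕ b * fromℕ b)) [α+β+γ]*εD≡D-[n+ε] εD*b³≡aE (begin
      (D ε m n - (fromℕ n + ε)) * (fromℕ b * (fromℕ b * fromℕ b))
        ≡⟨ solve 4 (λ D n e b → (D :- (n :+ e)) :* (b :* (b :* b)) := b :* (D :* (b :* b)) :- (n :* b :+ e :* b) :* (b :* b)) refl (D ε m n) (fromℕ n) ε (fromℕ b) ⟩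
      fromℕ b * (D ε m n * (fromℕ b * fromℕ b)) - (fromℕ n * fromℕ b + ε * fromℕ b) * (fromℕ b * fromℕ b)
        ≡⟨ cong₂ (λ s t → fromℕ b * s - t) fromℤ-E fromℤ-F ⟨
      fromℕ b * fromℤ E - fromℤ F
        ≡⟨ cong₂ (λ s t → s + t) (fromℤ-homo-* (+ b) E) (fromℤ-homo‿- F) ⟨
      fromℤ (+ b ℤ.* E) + fromℤ (ℤ.- F)
        ≡⟨ fromℤ-homo-+ (+ b ℤ.* E) (ℤ.- F) ⟨
      fromℤ (+ b ℤ.* E ℤ.- F) ∎)
      where open ≡-Reasoning

HasSmallPseudoinverse : ℚ → ℕ → ℕ → Set
HasSmallPseudoinverse ε m n =
  Σ[ P ∈ Mat n m ] IsPseudoinverse (Bmat ε m n) P × (∀ i j → RESℚ (P i j) ≤ 6 ℕ.* ⌈log₂ n ⌉)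

size : ℚ → ℕ
size ε = ↧ₙ ε ℕ.+ ∣ ↥ ε ∣

-- All numerators and denominators below are at most 6 (n · size ε)⁵, which is < n⁶ past the threshold.
threshold : ℚ → ℕ
threshold ε = suc (6 ℕ.* size ε ^ 5)

module Bounds (ε : ℚ) {m n : ℕ} (m≤n : m ≤ n) (N≤n : threshold ε ≤ n) where

  instance
    n≢0 : NonZero n
    n≢0 = ℕ.>-nonZero (ℕP.<-≤-trans (s≤s z≤n) N≤n)

  W = n ℕ.* size ε

  instance
    W≢0 : NonZero W
    W≢0 = ℕP.m*n≢0 n (size ε)

  open SizeBound W public

  RESℚ-≤-6⌈log₂n⌉ : ∀ q {x y} → q * fromℤ y ≡ fromℤ x → y ≢ 0ℤ → x ≲ 6 ·W^ 5 → y ≲ 6 ·W^ 5 →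
                     RESℚ q ≤ 6 ℕ.* ⌈log₂ n ⌉
  RESℚ-≤-6⌈log₂n⌉ q {x} {y} qy≡x y≢0 x≲ y≲ =
    ℕP.≤-trans (RESℚ-≤ q x y (n ^ 6) qy≡x y≢0 (below x≲) (below y≲)) (⌈log₂n^k⌉≤k*⌈log₂n⌉ n 6)
    where
    below : ∀ {z} → z ≲ 6 ·W^ 5 → ∣ z ∣ < n ^ 6
    below z≲ = ℕP.≤-<-trans (∣x∣≤ z≲) (6[n*c]^5<n^6 N≤n)

  c≤W : size ε ≤ W
  c≤W = ℕP.m≤n*m (size ε) n

  m≲ : + m ≲ 1 ·W^ 1
  m≲ = ≲-atom (ℕP.≤-trans m≤n (ℕP.m≤m*n n (size ε)))

  n≲ : + n ≲ 1 ·W^ 1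
  n≲ = ≲-atom (ℕP.m≤m*n n (size ε))

  b≲ : + ↧ₙ ε ≲ 1 ·W^ 1
  b≲ = ≲-atom (ℕP.≤-trans (ℕP.m≤m+n (↧ₙ ε) ∣ ↥ ε ∣) c≤W)

  a≲ : ↥ ε ≲ 1 ·W^ 1
  a≲ = ≲-atom (ℕP.≤-trans (ℕP.m≤n+m ∣ ↥ ε ∣ (↧ₙ ε)) c≤W)

module AllOnes (m n : ℕ) .{{_ : NonZero m}} .{{_ : NonZero n}} where

  open ℚ-Solver

  instance
    mn-nonZero : ℚ.NonZero (fromℕ (m ℕ.* n))
    mn-nonZero = ℕP.m*n≢0 m n

  u : ℚ
  u = 1/ fromℕ (m ℕ.* n)

  u*mn≡1 : u * fromℤ (+ m ℤ.* + n) ≡ 1ℚ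
  u*mn≡1 = trans (cong (λ t → u * fromℤ t) (sym (ℤP.pos-* m n))) (ℚP.*-inverseˡ (fromℕ (m ℕ.* n)))

  mnu≡1 : fromℕ m * fromℕ n * u ≡ 1ℚ
  mnu≡1 = trans (ℚP.*-comm _ u) (trans (cong (u *_) (sym (fromℤ-homo-* (+ m) (+ n)))) u*mn≡1)

  J⁺ : Mat n m
  J⁺ = u J+ 0ℚ I

  B≐J : Bmat 0ℚ m n ≐ 1ℚ J+ 0ℚ I
  B≐J = Bmat≐J+I 0ℚ m n

  BJ⁺≐ : Bmat 0ℚ m n ⊗ J⁺ ≐ fromℕ n * (1ℚ * u) J+ 0ℚ I
  BJ⁺≐ = ≐-trans (⊗-congʳ J⁺ B≐J) (J-⊗-J {k = n} 1ℚ u)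

  J⁺B≐ : J⁺ ⊗ Bmat 0ℚ m n ≐ fromℕ m * (u * 1ℚ) J+ 0ℚ I
  J⁺B≐ = ≐-trans (⊗-congˡ J⁺ B≐J) (J-⊗-J {k = m} u 1ℚ)

  J⁺-pseudoinverse : IsPseudoinverse (Bmat 0ℚ m n) J⁺
  J⁺-pseudoinverse = BJ⁺B≐B , J⁺BJ⁺≐J⁺ , ≐J+I⇒symmetric (fromℕ n * (1ℚ * u)) 0ℚ BJ⁺≐ , ≐J+I⇒symmetric (fromℕ m * (u * 1ℚ)) 0ℚ J⁺B≐
    where
    BJ⁺B≐B : Bmat 0ℚ m n ⊗ J⁺ ⊗ Bmat 0ℚ m n ≐ Bmat 0ℚ m n
    BJ⁺B≐B = ≐-trans (⊗-cong BJ⁺≐ B≐J) (≐-trans (J-⊗-J {k = m} (fromℕ n * (1ℚ * u)) 1ℚ) (≐-trans (J+I-cong {y = 0ℚ} coefficient refl) (≐-sym B≐J)))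
      where
      coefficient : fromℕ m * (fromℕ n * (1ℚ * u) * 1ℚ) ≡ 1ℚ
      coefficient = trans (solve 3 (λ m n u → m :* (n :* (con 1ℚ :* u) :* con 1ℚ) := m :* n :* u) refl (fromℕ m) (fromℕ n) u) mnu≡1
    J⁺BJ⁺≐J⁺ : J⁺ ⊗ Bmat 0ℚ m n ⊗ J⁺ ≐ J⁺
    J⁺BJ⁺≐J⁺ = ≐-trans (⊗-congʳ J⁺ J⁺B≐) (≐-trans (J-⊗-J {k = n} (fromℕ m * (u * 1ℚ)) u) (J+I-cong {y = 0ℚ} coefficient refl))
      where
      coefficient : fromℕ n * (fromℕ m * (u * 1ℚ) * u) ≡ u
      coefficient = begin
        fromℕ n * (fromℕ m * (u * 1ℚ) * u)   ≡⟨ solve 3 (λ m n u → n :* (m :* (u :* con 1ℚ) :* u) := m :* n :* u :* u) refl (fromℕ m) (fromℕ n) u ⟩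
        fromℕ m * fromℕ n * u * u            ≡⟨ cong (_* u) mnu≡1 ⟩
        1ℚ * u                               ≡⟨ ℚP.*-identityˡ u ⟩
        u                                    ∎
        where open ≡-Reasoning

  J⁺-entry : ∀ i j → J⁺ i j * fromℤ (+ m ℤ.* + n) ≡ fromℤ (+ 1)
  J⁺-entry i j = trans (cong (_* fromℤ (+ m ℤ.* + n)) (solve 2 (λ u d → u :+ con 0ℚ :* d := u) refl u (δ (toℕ i) (toℕ j)))) u*mn≡1

zero-case : ∀ {m n} .{{_ : NonZero m}} → m ≤ n → threshold 0ℚ ≤ n → HasSmallPseudoinverse 0ℚ m n
zero-case {m} {n} m≤n N≤n = J⁺ , J⁺-pseudoinverse , λ i j →
  RESℚ-≤-6⌈log₂n⌉ (J⁺ i j) (J⁺-entry i j) mn≢0 (≲-6·W^5 (≲-const 1)) (≲-6·W^5 (≲-* m≲ n≲))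
  where
  open Bounds 0ℚ m≤n N≤n
  open AllOnes m n
  mn≢0 : + m ℤ.* + n ≢ 0ℤ
  mn≢0 mn≡0 = ℕ.≢-nonZero⁻¹ (m ℕ.* n) {{ℕP.m*n≢0 m n}} (ℤP.+-injective (trans (ℤP.pos-* m n) mn≡0))

module NonzeroCase (ε : ℚ) {m n : ℕ} .{{_ : NonZero m}} (ε≢0 : ε ≢ 0ℚ) (m≤n : m ≤ n) (N≤n : threshold ε ≤ n) where

  open Bounds ε m≤n N≤n
  open Fractions ε {m} {n}

  ∣a∣≤c^5 : ∣ a ∣ ≤ size ε ^ 5
  ∣a∣≤c^5 = ℕP.≤-trans (ℕP.m≤n+m ∣ a ∣ b)
    (ℕP.≤-trans (ℕP.≤-reflexive (sym (ℕP.*-identityʳ (size ε)))) (ℕP.^-monoʳ-≤ (size ε) (ℕP.≤ᵇ⇒≤ 1 5 _)))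

  E≢0 : E ≢ 0ℤ
  E≢0 = Eℤ≢0 m n a b (ℕP.<-≤-trans (s≤s (ℕP.*-mono-≤ (ℕP.≤ᵇ⇒≤ 2 6 _) ∣a∣≤c^5)) N≤n)

  a≢0 : a ≢ 0ℤ
  a≢0 = ε≢0 ∘ ℚP.↥p≡0⇒p≡0 ε

  aE≢0 : a ℤ.* E ≢ 0ℤ
  aE≢0 aE≡0 with ℤP.i*j≡0⇒i≡0∨j≡0 a aE≡0
  ... | inj₁ a≡0 = a≢0 a≡0
  ... | inj₂ E≡0 = E≢0 E≡0

  D≢0 : D ε m n ≢ 0ℚ
  D≢0 D≡0 = E≢0 (cong ↥_ (begin
    fromℤ E                                ≡⟨ fromℤ-E ⟩
    D ε m n * (fromℕ b * fromℕ b)          ≡⟨ cong (_* (fromℕ b * fromℕ b)) D≡0 ⟩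
    0ℚ * (fromℕ b * fromℕ b)               ≡⟨ ℚP.*-zeroˡ (fromℕ b * fromℕ b) ⟩
    0ℚ                                     ∎))
    where open ≡-Reasoning

  instance
    ε-nonZero : ℚ.NonZero ε
    ε-nonZero = ℚ.≢-nonZero ε≢0
    D-nonZero : ℚ.NonZero (D ε m n)
    D-nonZero = ℚ.≢-nonZero D≢0

  ε²[1/ε]²≡1 : ε * ε * (1/ ε * 1/ ε) ≡ 1ℚ
  ε²[1/ε]²≡1 = trans (solve 2 (λ e i → e :* e :* (i :* i) := (e :* i) :* (e :* i)) refl ε (1/ ε))
                     (cong₂ _*_ (ℚP.*-inverseʳ ε) (ℚP.*-inverseʳ ε))
    where open ℚ-Solver

  open Entries m≤n (1/ ε * 1/ ε) (1/ D ε m n) ε²[1/ε]²≡1 (ℚP.*-inverseʳ (D ε m n))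

  E≲ : E ≲ 4 ·W^ 4
  E≲ = ≲-+ (≲-* m≲ (≲-+ (≲-* n≲ (≲-* b≲ b≲)) (≲-* (≲-* (≲-const 2) b≲) a≲))) (≲-* a≲ a≲)

  F≲ : F ≲ 2 ·W^ 4
  F≲ = ≲-* (≲-+ (≲-* n≲ b≲) a≲) (≲-* b≲ b≲)

  α-small : RESℚ α ≤ 6 ℕ.* ⌈log₂ n ⌉
  α-small = RESℚ-≤-6⌈log₂n⌉ α α-fraction E≢0 (≲-6·W^5 (≲-* b≲ b≲)) (≲-6·W^5 E≲)

  α+β-small : RESℚ (α + β) ≤ 6 ℕ.* ⌈log₂ n ⌉
  α+β-small = RESℚ-≤-6⌈log₂n⌉ (α + β) [α+β]-fraction aE≢0 (≲-6·W^5 (≲-neg F≲)) (≲-6·W^5 (≲-* a≲ E≲))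

  α+β+γ-small : RESℚ (α + β + γ) ≤ 6 ℕ.* ⌈log₂ n ⌉
  α+β+γ-small = RESℚ-≤-6⌈log₂n⌉ (α + β + γ) [α+β+γ]-fraction aE≢0 (≲-6·W^5 (≲-+ (≲-* b≲ E≲) (≲-neg F≲))) (≲-6·W^5 (≲-* a≲ E≲))

  B⁺-small : ∀ i j → RESℚ (B⁺ i j) ≤ 6 ℕ.* ⌈log₂ n ⌉
  B⁺-small i j = [ bounded α-small , [ bounded α+β-small , bounded α+β+γ-small ]′ ]′ (B⁺-entries i j)
    where
    bounded : ∀ {q} → RESℚ q ≤ 6 ℕ.* ⌈log₂ n ⌉ → B⁺ i j ≡ q → RESℚ (B⁺ i j) ≤ 6 ℕ.* ⌈log₂ n ⌉
    bounded q-small refl = q-small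

  B⁺-small-pseudoinverse : HasSmallPseudoinverse ε m n
  B⁺-small-pseudoinverse = B⁺ , B⁺-pseudoinverse , B⁺-small

small-pseudoinverse : ∀ ε {m n} → 1 ≤ m → m ≤ n → threshold ε ≤ n → HasSmallPseudoinverse ε m n
small-pseudoinverse ε 1≤m m≤n N≤n with ε ℚP.≟ 0ℚ
... | yes refl = zero-case {{ℕ.>-nonZero 1≤m}} m≤n N≤n
... | no  ε≢0  = NonzeroCase.B⁺-small-pseudoinverse ε {{ℕ.>-nonZero 1≤m}} ε≢0 m≤n N≤n

theorem5 : (ε : ℚ) → ∃[ C ] ∃[ N ] ∀ (m n : ℕ) → 1 ≤ m → m ≤ n → N ≤ n →
    Σ (Mat n m) (IsPseudoinverse (Bmat ε m n)) ×
    (∀ (P : Mat n m) → IsPseudoinverse (Bmat ε m n) P → RES P ≤ C ℕ.* ⌈log₂ n ⌉)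
theorem5 ε = 6 , threshold ε , λ m n 1≤m m≤n N≤n →
  let (P , P-pinv , P-small) = small-pseudoinverse ε 1≤m m≤n N≤n in
  (P , P-pinv) , λ P′ P′-pinv →
    RES-≤ P′ (λ i j → subst (λ q → RESℚ q ≤ 6 ℕ.* ⌈log₂ n ⌉) (pseudoinverse-unique P-pinv P′-pinv i j) (P-small i j))
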